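{- Let $G$ be a finite simple graph of order $n$, and let $\bar{G}$ be its complement. Let $a(G)$ be the number of subgraphs of $\bar{G}$ isomorphic to $K_{2p,2q}$ (for some positive integers $p,q$), and let $b(G)$ be the number of subgraphs of $\bar{G}$ isomorphic to $K_{2p+1,2q+1}$ (for some nonnegative integers $p,q$). Then the number $d(G)$ of dominating sets of $G$ satisfies \[ d(G) = 2^n - 1 + 2\,[a(G) - b(G)]. \]
   Context: For a graph $G=(V,E)$ and $W\subseteq V$, $N_G(W)=\bigcup_{w\in W}N_G(w)\setminus W$ and $N_G[W]=N_G(W)\cup W$, where $N_G(w)$ is the set of vertices adjacent to $w$. A dominating set of $G$ is a set $W\subseteq V$ with $N_G[W]=V$; $d(G)$ is the number of dominating sets of $G$. Subgraphs isomorphic to a complete bipartite graph $K_{s,t}$ (with $s,t\ge 1$) are counted as distinct edge sets $F\subseteq E(\bar{G})$ such that the edges of $F$ form a graph isomorphic to $K_{s,t}$ (vertices not incident to $F$ are disregarded); thus $a(G)$ counts such edge sets with $s,t$ both even and $b(G)$ counts such edge sets with $s,t$ both odd (including single edges, $K_{1,1}$). -}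

module Defs where

open import Data.Nat using (ℕ; zero; suc; _%_; _≡ᵇ_; _≤ᵇ_)
open import Data.Bool using (Bool; true; false; _∧_; _∨_; not; if_then_else_)
open import Data.Fin using (Fin; _≟_)
open import Data.Fin.Subset using (Subset; ∣_∣)
open import Data.Vec using (Vec; []; _∷_; lookup)
open import Data.List using (List; []; _∷_; map; _++_; length; filter; allFin)
import Data.List as L
import Data.Bool.ListAction as BL
open import Data.Product using (_×_)
open import Relation.Binary.PropositionalEquality using (_≡_)
open import Relation.Nullary.Decidable using (⌊_⌋)
open import Data.Bool.Properties using (T?)

record SimpleGraph (n : ℕ) : Set where
  field
    adj       : Fin n → Fin n → Bool
    adj-sym   : ∀ i j → adj i j ≡ adj j i
    adj-irrefl : ∀ i → adj i i ≡ false
open SimpleGraph public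

allB : ∀ {A : Set} → List A → (A → Bool) → Bool
allB xs p = BL.all p xs

anyB : ∀ {A : Set} → List A → (A → Bool) → Bool
anyB xs p = BL.any p xs

_∈ˢ_ : ∀ {n} → Fin n → Subset n → Bool
i ∈ˢ S = lookup S i

allSubsets : (n : ℕ) → List (Subset n)
allSubsets zero = [] ∷ []
allSubsets (suc n) = map (true ∷_) (allSubsets n) ++ map (false ∷_) (allSubsets n)

count : ∀ {A : Set} → (A → Bool) → List A → ℕ
count p xs = length (filter (λ x → T? (p x)) xs)

isDominating : ∀ {n} → SimpleGraph n → Subset n → Bool
isDominating {n} G W =
  allB (allFin n) λ v → (v ∈ˢ W) ∨ anyB (allFin n) (λ w → (w ∈ˢ W) ∧ adj G v w)

d : ∀ {n} → SimpleGraph n → ℕ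
d {n} G = count (isDominating G) (allSubsets n)

-- Edge sets on vertex set Fin n, represented as n×n boolean matrices
-- (entry (i,j) = true iff {i,j} ∈ F).  Every matrix is enumerated once.
EdgeSet : ℕ → Set
EdgeSet n = Vec (Subset n) n

allVecs : ∀ {A : Set} → List A → (m : ℕ) → List (Vec A m)
allVecs xs zero = [] ∷ []
allVecs xs (suc m) = L.concatMap (λ x → map (x ∷_) (allVecs xs m)) xs

allEdgeSets : (n : ℕ) → List (EdgeSet n)
allEdgeSets n = allVecs (allSubsets n) n

inF : ∀ {n} → EdgeSet n → Fin n → Fin n → Bool
inF F i j = lookup (lookup F i) j

⊆coEdges : ∀ {n} → SimpleGraph n → EdgeSet n → Bool
⊆coEdges {n} G F = allB (allFin n) λ i → allB (allFin n) λ j →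
  not (inF F i j) ∨ (not ⌊ i ≟ j ⌋ ∧ not (adj G i j))

isCompleteBipartiteOn : ∀ {n} → EdgeSet n → Subset n → Subset n → Bool
isCompleteBipartiteOn {n} F S T =
  (1 ≤ᵇ ∣ S ∣) ∧ (1 ≤ᵇ ∣ T ∣) ∧
  allB (allFin n) (λ i → not ((i ∈ˢ S) ∧ (i ∈ˢ T))) ∧
  allB (allFin n) (λ i → allB (allFin n) λ j →
    inF F i j ≡ᵇ' (((i ∈ˢ S) ∧ (j ∈ˢ T)) ∨ ((i ∈ˢ T) ∧ (j ∈ˢ S))))
  where
  _≡ᵇ'_ : Bool → Bool → Bool
  true ≡ᵇ' b = b
  false ≡ᵇ' b = not b

isEven isOdd : ℕ → Bool
isEven k = (k % 2) ≡ᵇ 0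
isOdd k = not (isEven k)

-- F ⊆ E(Ḡ) forms a K_{s,t} with s,t both even (s,t ≥ 2 automatically)
isEvenEven : ∀ {n} → SimpleGraph n → EdgeSet n → Bool
isEvenEven {n} G F = ⊆coEdges G F ∧
  anyB (allSubsets n) λ S → anyB (allSubsets n) λ T →
    isCompleteBipartiteOn F S T ∧ isEven ∣ S ∣ ∧ isEven ∣ T ∣

isOddOdd : ∀ {n} → SimpleGraph n → EdgeSet n → Bool
isOddOdd {n} G F = ⊆coEdges G F ∧
  anyB (allSubsets n) λ S → anyB (allSubsets n) λ T →
    isCompleteBipartiteOn F S T ∧ isOdd ∣ S ∣ ∧ isOdd ∣ T ∣

a b : ∀ {n} → SimpleGraph n → ℕ
a {n} G = count (isEvenEven G) (allEdgeSets n)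
b {n} G = count (isOddOdd G) (allEdgeSets n)

module Submission where

-- For W ⊆ V let V ∖ N[W] be the set of vertices W does not dominate.  By
-- inclusion–exclusion, [V ∖ N[W] = ∅] = Σ_{U ⊆ V ∖ N[W]} (-1)^|U|, hence
--   d(G) = Σ_W Σ_{U ⊆ V ∖ N[W]} (-1)^|U|.
-- The terms with U = ∅ contribute 2^n, those with W = ∅ ≠ U contribute -1.
-- For nonempty W and U, U ⊆ V ∖ N[W] says that every pair in W × U is an edge
-- of the complement Ḡ: (W, U) is a "co-biclique", a symmetric relation.
-- Averaging over the two roles, a co-biclique pair contributes
-- ((-1)^|W| + (-1)^|U|) / 2, that is +1 if both sides are even, -1 if both
-- are odd and 0 otherwise.  Finally, ordered co-biclique pairs correspond
-- two-to-one to the edge sets F ⊆ E(Ḡ) forming some K_{s,t}, because such an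
-- edge set determines its two sides up to order.

open import Defs
open import Data.Nat as N using (ℕ; zero; suc; _≤_)
open import Data.Integer using (ℤ; +_; _+_; _-_; _*_; _^_; 0ℤ; 1ℤ; -1ℤ)
import Data.Nat.Properties as NP
import Data.Integer.Properties as ℤP
open import Data.Integer.Tactic.RingSolver using (solve-∀)
open import Data.Bool using (Bool; true; false; _∧_; _∨_; not; T; if_then_else_) renaming (_≟_ to _≟ᵇ_)
open import Data.Bool.Properties using (T-≡; T-not-≡; T-∧; T-∨; not-involutive; ∧-assoc; ∧-comm; ∨-comm; ∨-identityʳ)
import Data.Bool.ListAction as BL
open import Data.Fin using (Fin; zero; suc; _≟_)
open import Data.Fin.Subset using (Subset; ∣_∣) renaming (⊥ to ∅; ⊤ to full)
open import Data.Fin.Subset.Properties using (∣⊥∣≡0)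
open import Data.Vec using (Vec; []; _∷_; lookup; tabulate)
open import Data.Vec.Properties using (≡-dec; ∷-injectiveˡ; ∷-injectiveʳ; lookup∘tabulate; lookup-replicate; tabulate-cong)
open import Data.Vec.Relation.Binary.Pointwise.Extensional using (ext; Pointwise-≡⇒≡)
open import Data.Fin.Properties using (¬∀⟶∃¬)
open import Data.List using (List; []; _∷_; map; _++_; concatMap; allFin)
open import Data.List.Properties using (map-cong; map-tabulate)
import Data.List.Relation.Unary.All as All
open import Data.List.Relation.Unary.All.Properties using (all⁺; all⁻)
open import Data.List.Relation.Unary.Any using (satisfied)
open import Data.List.Relation.Unary.Any.Properties using (any⁺; any⁻)
open import Data.List.Membership.Propositional using (lose)
open import Data.List.Membership.Propositional.Properties using (∈-allFin)
open import Data.Product using (_×_; _,_; ∃; proj₁; proj₂)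
open import Data.Sum using (_⊎_; inj₁; inj₂; [_,_])
open import Data.Empty using (⊥-elim)
open import Function using (_∘_; id; _⇔_; mk⇔; Equivalence)
open import Relation.Binary.PropositionalEquality using (_≡_; _≢_; refl; sym; trans; cong; cong₂; subst; module ≡-Reasoning)
open import Relation.Binary.Definitions using (DecidableEquality)
open import Relation.Nullary using (¬_; yes; no; contradiction)
open import Relation.Nullary.Decidable using (⌊_⌋; T?)

open Equivalence using (to; from)

private
  variable
    A B : Set

T-injective : ∀ {x y} → (T x → T y) → (T y → T x) → x ≡ y
T-injective {true} {true} _ _ = refl
T-injective {true} {false} x⇒y _ = ⊥-elim (x⇒y _)
T-injective {false} {true} _ y⇒x = ⊥-elim (y⇒x _)
T-injective {false} {false} _ _ = refl

T-not : ∀ {x} → T (not x) ⇔ (¬ T x)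
T-not {true} = mk⇔ (λ ()) (λ ¬true → ¬true _)
T-not {false} = mk⇔ (λ _ ()) (λ _ → _)

T-implies : ∀ {x y} → T (not x ∨ y) ⇔ (T x → T y)
T-implies {true} = mk⇔ (λ y _ → y) (λ x⇒y → x⇒y _)
T-implies {false} = mk⇔ (λ _ ()) (λ _ → _)

T-allFin : ∀ {n} {p : Fin n → Bool} → T (allB (allFin n) p) ⇔ (∀ i → T (p i))
T-allFin {n} {p} = mk⇔ (λ h i → All.lookup (all⁺ p (allFin n) h) (∈-allFin i))
                       (λ h → all⁻ p {xs = allFin n} (All.tabulate (λ {i} _ → h i)))

¬T-allFin : ∀ {n} {p : Fin n → Bool} → ¬ T (allB (allFin n) p) → ∃ λ i → ¬ T (p i)
¬T-allFin {n} {p} fails = ¬∀⟶∃¬ n (T ∘ p) (T? ∘ p) (fails ∘ from T-allFin)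

T-anyFin : ∀ {n} {p : Fin n → Bool} → T (anyB (allFin n) p) ⇔ ∃ (T ∘ p)
T-anyFin {n} {p} = mk⇔ (satisfied ∘ any⁻ p (allFin n))
                       (λ (i , pi) → any⁺ p (lose (∈-allFin i) pi))

allFin-suc : ∀ {n} (p : Fin (suc n) → Bool) → allB (allFin (suc n)) p ≡ p zero ∧ allB (allFin n) (p ∘ suc)
allFin-suc {n} p = cong (λ bs → p zero ∧ BL.and bs) (trans (map-tabulate suc p) (sym (map-tabulate id (p ∘ suc))))

vec-ext : ∀ {m} {u v : Vec A m} → (∀ i → lookup u i ≡ lookup v i) → u ≡ v
vec-ext same = Pointwise-≡⇒≡ (ext same)

∑ : {A : Set} → List A → (A → ℤ) → ℤ
∑ [] f = 0ℤ
∑ (x ∷ xs) f = f x + ∑ xs f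

ι : Bool → ℤ
ι true = 1ℤ
ι false = 0ℤ

ι-true : ∀ {b} → T b → ι b ≡ 1ℤ
ι-true {true} _ = refl

ι-false : ∀ {b} → ¬ T b → ι b ≡ 0ℤ
ι-false {true} ¬b = ⊥-elim (¬b _)
ι-false {false} _ = refl

ι-∧ : ∀ x y → ι (x ∧ y) ≡ ι x * ι y
ι-∧ true y = sym (ℤP.*-identityˡ (ι y))
ι-∧ false y = refl

ι-∧₃ : ∀ x y z (c : ℤ) → ι x * (ι y * (ι z * c)) ≡ ι (x ∧ (y ∧ z)) * c
ι-∧₃ x y z c = begin
  ι x * (ι y * (ι z * c))   ≡⟨ reassociate (ι x) (ι y) (ι z) c ⟩
  (ι x * (ι y * ι z)) * c   ≡⟨ cong (λ k → (ι x * k) * c) (ι-∧ y z) ⟨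
  (ι x * ι (y ∧ z)) * c     ≡⟨ cong (_* c) (ι-∧ x (y ∧ z)) ⟨
  ι (x ∧ (y ∧ z)) * c       ∎
  where
  open ≡-Reasoning
  reassociate : ∀ a b d e → a * (b * (d * e)) ≡ (a * (b * d)) * e
  reassociate = solve-∀

count≡∑ : (p : A → Bool) (xs : List A) → + count p xs ≡ ∑ xs (ι ∘ p)
count≡∑ p [] = refl
count≡∑ p (x ∷ xs) with p x
... | true = trans (ℤP.pos-+ 1 (count p xs)) (cong (_+_ 1ℤ) (count≡∑ p xs))
... | false = trans (count≡∑ p xs) (sym (ℤP.+-identityˡ _))

∑-cong : (xs : List A) {f g : A → ℤ} → (∀ x → f x ≡ g x) → ∑ xs f ≡ ∑ xs g
∑-cong [] f≗g = refl
∑-cong (x ∷ xs) f≗g = cong₂ _+_ (f≗g x) (∑-cong xs f≗g)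

∑-vanish : (xs : List A) {f : A → ℤ} → (∀ x → f x ≡ 0ℤ) → ∑ xs f ≡ 0ℤ
∑-vanish [] f≗0 = refl
∑-vanish (x ∷ xs) f≗0 = cong₂ _+_ (f≗0 x) (∑-vanish xs f≗0)

∑-vanish-∄ : (p : A → Bool) (xs : List A) {f : A → ℤ} →
             (∀ x → ¬ T (p x) → f x ≡ 0ℤ) → ¬ T (BL.any p xs) → ∑ xs f ≡ 0ℤ
∑-vanish-∄ p [] f-support none = refl
∑-vanish-∄ p (x ∷ xs) f-support none =
  cong₂ _+_ (f-support x (none ∘ from T-∨ ∘ inj₁)) (∑-vanish-∄ p xs f-support (none ∘ from T-∨ ∘ inj₂))

∑-+ : (xs : List A) (f g : A → ℤ) → ∑ xs (λ x → f x + g x) ≡ ∑ xs f + ∑ xs g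
∑-+ [] f g = refl
∑-+ (x ∷ xs) f g = trans (cong (_+_ (f x + g x)) (∑-+ xs f g)) (interchange (f x) (g x) _ _)
  where
  interchange : ∀ a b c d → (a + b) + (c + d) ≡ (a + c) + (b + d)
  interchange = solve-∀

∑-- : (xs : List A) (f g : A → ℤ) → ∑ xs (λ x → f x - g x) ≡ ∑ xs f - ∑ xs g
∑-- [] f g = refl
∑-- (x ∷ xs) f g = trans (cong (_+_ (f x - g x)) (∑-- xs f g)) (interchange (f x) (g x) _ _)
  where
  interchange : ∀ a b c d → (a - b) + (c - d) ≡ (a + c) - (b + d)
  interchange = solve-∀

∑-*ˡ : (xs : List A) (c : ℤ) (f : A → ℤ) → ∑ xs (λ x → c * f x) ≡ c * ∑ xs f
∑-*ˡ [] c f = sym (ℤP.*-zeroʳ c)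
∑-*ˡ (x ∷ xs) c f = trans (cong (_+_ (c * f x)) (∑-*ˡ xs c f)) (sym (ℤP.*-distribˡ-+ c (f x) _))

∑-scaled-difference : (xs : List A) (c : ℤ) (f g : A → ℤ) →
                      ∑ xs (λ x → c * (f x - g x)) ≡ c * (∑ xs f - ∑ xs g)
∑-scaled-difference xs c f g = trans (∑-*ˡ xs c _) (cong (_*_ c) (∑-- xs f g))

∑-++ : (xs ys : List A) (f : A → ℤ) → ∑ (xs ++ ys) f ≡ ∑ xs f + ∑ ys f
∑-++ [] ys f = sym (ℤP.+-identityˡ _)
∑-++ (x ∷ xs) ys f = trans (cong (_+_ (f x)) (∑-++ xs ys f)) (sym (ℤP.+-assoc (f x) _ _))

∑-map : (g : B → A) (ys : List B) (f : A → ℤ) → ∑ (map g ys) f ≡ ∑ ys (f ∘ g)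
∑-map g [] f = refl
∑-map g (y ∷ ys) f = cong (_+_ (f (g y))) (∑-map g ys f)

∑-concatMap : (g : B → List A) (ys : List B) (f : A → ℤ) →
              ∑ (concatMap g ys) f ≡ ∑ ys (λ y → ∑ (g y) f)
∑-concatMap g [] f = refl
∑-concatMap g (y ∷ ys) f = trans (∑-++ (g y) _ f) (cong (_+_ (∑ (g y) f)) (∑-concatMap g ys f))

∑-swap : (xs : List A) (ys : List B) (f : A → B → ℤ) →
         ∑ xs (λ x → ∑ ys (f x)) ≡ ∑ ys (λ y → ∑ xs (λ x → f x y))
∑-swap [] ys f = sym (∑-vanish ys (λ _ → refl))
∑-swap (x ∷ xs) ys f = trans (cong (_+_ (∑ ys (f x))) (∑-swap xs ys f))
                             (sym (∑-+ ys (f x) (λ y → ∑ xs (λ x′ → f x′ y))))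

-- A list enumerates its type when every element occurs exactly once,
-- expressed through sums: summing a function supported on one point
-- returns its value at that point.
IsEnumeration : {A : Set} → List A → Set
IsEnumeration {A} xs = ∀ (f : A → ℤ) x₀ → (∀ x → x ≢ x₀ → f x ≡ 0ℤ) → ∑ xs f ≡ f x₀

∑-two-points : {A : Set} → DecidableEquality A → {xs : List A} → IsEnumeration xs →
               (f : A → ℤ) {x₁ x₂ : A} → x₁ ≢ x₂ →
               (∀ x → x ≢ x₁ → x ≢ x₂ → f x ≡ 0ℤ) → ∑ xs f ≡ f x₁ + f x₂
∑-two-points {A} _≟_ {xs} enum f {x₁} {x₂} x₁≢x₂ f-support = begin
  ∑ xs f                                  ≡⟨ ∑-cong xs split ⟩
  ∑ xs (λ x → at x₁ x + at x₂ x)          ≡⟨ ∑-+ xs (at x₁) (at x₂) ⟩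
  ∑ xs (at x₁) + ∑ xs (at x₂)             ≡⟨ cong₂ _+_ (enum (at x₁) x₁ (off x₁)) (enum (at x₂) x₂ (off x₂)) ⟩
  at x₁ x₁ + at x₂ x₂                     ≡⟨ cong₂ _+_ (on x₁) (on x₂) ⟩
  f x₁ + f x₂                             ∎
  where
  open ≡-Reasoning
  at : A → A → ℤ
  at y x with x ≟ y
  ... | yes _ = f x
  ... | no _ = 0ℤ
  on : ∀ y → at y y ≡ f y
  on y with y ≟ y
  ... | yes _ = refl
  ... | no y≢y = contradiction refl y≢y
  off : ∀ y x → x ≢ y → at y x ≡ 0ℤ
  off y x x≢y with x ≟ y
  ... | yes x≡y = contradiction x≡y x≢y
  ... | no _ = refl
  split : ∀ x → f x ≡ at x₁ x + at x₂ x
  split x with x ≟ x₁ | x ≟ x₂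
  ... | yes refl | yes refl = contradiction refl x₁≢x₂
  ... | yes _ | no _ = sym (ℤP.+-identityʳ _)
  ... | no _ | yes _ = sym (ℤP.+-identityˡ _)
  ... | no x≢x₁ | no x≢x₂ = f-support x x≢x₁ x≢x₂

-- Double sum of a symmetric, irreflexive relation whose solutions are "rigid":
-- any two solutions agree up to swapping.  Then the solutions are either none
-- or exactly one pair (x, y), (y, x), so the double sum is 0 or 2.
∑∑-unordered-pair : {A : Set} → DecidableEquality A → {xs : List A} → IsEnumeration xs →
  (q : A → A → Bool) →
  (∀ {x y} → T (q x y) → T (q y x)) →
  (∀ {x} → ¬ T (q x x)) →
  (∀ {x y x′ y′} → T (q x y) → T (q x′ y′) → (x ≡ x′ × y ≡ y′) ⊎ (x ≡ y′ × y ≡ x′)) →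
  ∑ xs (λ x → ∑ xs (λ y → ι (q x y))) ≡ + 2 * ι (BL.any (λ x → BL.any (q x) xs) xs)
∑∑-unordered-pair {A} _≟_ {xs} enum q q-sym q-irrefl q-rigid
  with T? (BL.any (λ x → BL.any (q x) xs) xs)
... | no none = trans (∑-vanish-∄ _ xs (λ x → ∑-vanish-∄ (q x) xs (λ y → ι-false)) none)
                      (cong (_*_ (+ 2)) (sym (ι-false none)))
... | yes some with satisfied (any⁻ _ xs some)
... | x₀ , some′ with satisfied (any⁻ (q x₀) xs some′)
... | y₀ , q₀ = begin
  ∑ xs (λ x → ∑ xs (λ y → ι (q x y)))   ≡⟨ ∑-two-points _≟_ {xs} enum row x₀≢y₀ other-rows-vanish ⟩
  row x₀ + row y₀                       ≡⟨ cong₂ _+_ (row-of-solution q₀) (row-of-solution (q-sym q₀)) ⟩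
  + 2 * 1ℤ                              ≡⟨ cong (_*_ (+ 2)) (ι-true some) ⟨
  + 2 * ι (BL.any (λ x → BL.any (q x) xs) xs) ∎
  where
  open ≡-Reasoning
  row : A → ℤ
  row x = ∑ xs (λ y → ι (q x y))
  x₀≢y₀ : x₀ ≢ y₀
  x₀≢y₀ refl = q-irrefl q₀
  row-of-solution : ∀ {x y} → T (q x y) → row x ≡ 1ℤ
  row-of-solution {x} {y} qxy = trans (enum _ y (λ y′ y′≢y → ι-false (other-column y′≢y))) (ι-true qxy)
    where
    other-column : ∀ {y′} → y′ ≢ y → ¬ T (q x y′)
    other-column y′≢y qxy′ with q-rigid qxy′ qxy
    ... | inj₁ (_ , y′≡y) = y′≢y y′≡y
    ... | inj₂ (refl , _) = q-irrefl qxy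
  other-rows-vanish : ∀ x → x ≢ x₀ → x ≢ y₀ → row x ≡ 0ℤ
  other-rows-vanish x x≢x₀ x≢y₀ = ∑-vanish xs (λ y → ι-false (λ qxy → [ x≢x₀ ∘ proj₁ , x≢y₀ ∘ proj₁ ] (q-rigid qxy q₀)))

∑-allSubsets-suc : ∀ n (f : Subset (suc n) → ℤ) →
  ∑ (allSubsets (suc n)) f ≡ ∑ (allSubsets n) (f ∘ (true ∷_)) + ∑ (allSubsets n) (f ∘ (false ∷_))
∑-allSubsets-suc n f = trans (∑-++ (map (true ∷_) (allSubsets n)) _ f)
  (cong₂ _+_ (∑-map (true ∷_) (allSubsets n) f) (∑-map (false ∷_) (allSubsets n) f))

allSubsets-enumerates : ∀ n → IsEnumeration (allSubsets n)
allSubsets-enumerates zero f [] _ = ℤP.+-identityʳ _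
allSubsets-enumerates (suc n) f (true ∷ U₀) f-support = begin
  ∑ (allSubsets (suc n)) f                         ≡⟨ ∑-allSubsets-suc n f ⟩
  ∑ (allSubsets n) (f ∘ (true ∷_)) + ∑ (allSubsets n) (f ∘ (false ∷_))
    ≡⟨ cong₂ _+_ (allSubsets-enumerates n _ U₀ (λ U U≢U₀ → f-support _ (U≢U₀ ∘ ∷-injectiveʳ)))
                 (∑-vanish (allSubsets n) (λ U → f-support _ λ ())) ⟩
  f (true ∷ U₀) + 0ℤ                               ≡⟨ ℤP.+-identityʳ _ ⟩
  f (true ∷ U₀)                                    ∎
  where open ≡-Reasoning
allSubsets-enumerates (suc n) f (false ∷ U₀) f-support = begin
  ∑ (allSubsets (suc n)) f                         ≡⟨ ∑-allSubsets-suc n f ⟩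
  ∑ (allSubsets n) (f ∘ (true ∷_)) + ∑ (allSubsets n) (f ∘ (false ∷_))
    ≡⟨ cong₂ _+_ (∑-vanish (allSubsets n) (λ U → f-support _ λ ()))
                 (allSubsets-enumerates n _ U₀ (λ U U≢U₀ → f-support _ (U≢U₀ ∘ ∷-injectiveʳ))) ⟩
  0ℤ + f (false ∷ U₀)                              ≡⟨ ℤP.+-identityˡ _ ⟩
  f (false ∷ U₀)                                   ∎
  where open ≡-Reasoning

allVecs-enumerates : {xs : List A} → IsEnumeration xs → ∀ m → IsEnumeration (allVecs xs m)
allVecs-enumerates enum zero f [] _ = ℤP.+-identityʳ _
allVecs-enumerates {xs = xs} enum (suc m) f (y₀ ∷ v₀) f-support = begin
  ∑ (allVecs xs (suc m)) f                          ≡⟨ ∑-concatMap (λ y → map (y ∷_) (allVecs xs m)) xs f ⟩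
  ∑ xs (λ y → ∑ (map (y ∷_) (allVecs xs m)) f)      ≡⟨ ∑-cong xs (λ y → ∑-map (y ∷_) (allVecs xs m) f) ⟩
  ∑ xs (λ y → ∑ (allVecs xs m) (f ∘ (y ∷_)))        ≡⟨ enum _ y₀ other-heads-vanish ⟩
  ∑ (allVecs xs m) (f ∘ (y₀ ∷_))                    ≡⟨ allVecs-enumerates enum m _ v₀ other-tails-vanish ⟩
  f (y₀ ∷ v₀)                                       ∎
  where
  open ≡-Reasoning
  other-heads-vanish : ∀ y → y ≢ y₀ → ∑ (allVecs xs m) (f ∘ (y ∷_)) ≡ 0ℤ
  other-heads-vanish y y≢y₀ = ∑-vanish (allVecs xs m) (λ v → f-support _ (y≢y₀ ∘ ∷-injectiveˡ))
  other-tails-vanish : ∀ v → v ≢ v₀ → f (y₀ ∷ v) ≡ 0ℤ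
  other-tails-vanish v v≢v₀ = f-support _ (v≢v₀ ∘ ∷-injectiveʳ)

allEdgeSets-enumerates : ∀ n → IsEnumeration (allEdgeSets n)
allEdgeSets-enumerates n = allVecs-enumerates (allSubsets-enumerates n) n

_⊆ᵇ_ : ∀ {n} → Subset n → Subset n → Bool
[] ⊆ᵇ [] = true
(u ∷ U) ⊆ᵇ (x ∷ X) = (not u ∨ x) ∧ (U ⊆ᵇ X)

⊆ᵇ-sound : ∀ {n} (U X : Subset n) → T (U ⊆ᵇ X) → ∀ i → T (i ∈ˢ U) → T (i ∈ˢ X)
⊆ᵇ-sound (true ∷ U) (true ∷ X) _ zero _ = _
⊆ᵇ-sound (u ∷ U) (x ∷ X) h (suc i) = ⊆ᵇ-sound U X (proj₂ (to (T-∧ {not u ∨ x}) h)) i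

⊆ᵇ-complete : ∀ {n} (U X : Subset n) → (∀ i → T (i ∈ˢ U) → T (i ∈ˢ X)) → T (U ⊆ᵇ X)
⊆ᵇ-complete [] [] _ = _
⊆ᵇ-complete (false ∷ U) (x ∷ X) h = ⊆ᵇ-complete U X (h ∘ suc)
⊆ᵇ-complete (true ∷ U) (true ∷ X) h = ⊆ᵇ-complete U X (h ∘ suc)
⊆ᵇ-complete (true ∷ U) (false ∷ X) h = h zero _

∅⊆ᵇ : ∀ {n} (X : Subset n) → ∅ ⊆ᵇ X ≡ true
∅⊆ᵇ [] = refl
∅⊆ᵇ (x ∷ X) = ∅⊆ᵇ X

⊆ᵇfull : ∀ {n} (U : Subset n) → U ⊆ᵇ full ≡ true
⊆ᵇfull [] = refl
⊆ᵇfull (true ∷ U) = ⊆ᵇfull U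
⊆ᵇfull (false ∷ U) = ⊆ᵇfull U

isEmptyᵇ : ∀ {n} → Subset n → Bool
isEmptyᵇ {n} X = allB (allFin n) (λ i → not (i ∈ˢ X))

nonEmptyᵇ : ∀ {n} → Subset n → Bool
nonEmptyᵇ U = 1 N.≤ᵇ ∣ U ∣

nonEmpty⇒member : ∀ {n} (X : Subset n) → T (nonEmptyᵇ X) → ∃ λ i → T (i ∈ˢ X)
nonEmpty⇒member (true ∷ X) _ = zero , _
nonEmpty⇒member (false ∷ X) X≠∅ with nonEmpty⇒member X X≠∅
... | i , i∈X = suc i , i∈X

inclusion-exclusion : ∀ {n} (X : Subset n) →
  ∑ (allSubsets n) (λ U → ι (U ⊆ᵇ X) * -1ℤ ^ ∣ U ∣) ≡ ι (isEmptyᵇ X)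
inclusion-exclusion [] = refl
inclusion-exclusion {suc n} (true ∷ X) = begin
  ∑ (allSubsets (suc n)) (λ U → ι (U ⊆ᵇ (true ∷ X)) * -1ℤ ^ ∣ U ∣)
    ≡⟨ ∑-allSubsets-suc n _ ⟩
  ∑ (allSubsets n) (λ U → ι (U ⊆ᵇ X) * (-1ℤ * -1ℤ ^ ∣ U ∣)) + S
    ≡⟨ cong (_+ S) (trans (∑-cong (allSubsets n) (λ U → pull-sign (ι (U ⊆ᵇ X)) _))
                          (∑-*ˡ (allSubsets n) -1ℤ _)) ⟩
  -1ℤ * S + S                                      ≡⟨ cancel S ⟩
  0ℤ                                               ≡⟨ cong ι (allFin-suc (λ i → not (i ∈ˢ (true ∷ X)))) ⟨
  ι (isEmptyᵇ (true ∷ X))                          ∎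
  where
  open ≡-Reasoning
  S = ∑ (allSubsets n) (λ U → ι (U ⊆ᵇ X) * -1ℤ ^ ∣ U ∣)
  pull-sign : ∀ a s → a * (-1ℤ * s) ≡ -1ℤ * (a * s)
  pull-sign = solve-∀
  cancel : ∀ z → -1ℤ * z + z ≡ 0ℤ
  cancel = solve-∀
inclusion-exclusion {suc n} (false ∷ X) = begin
  ∑ (allSubsets (suc n)) (λ U → ι (U ⊆ᵇ (false ∷ X)) * -1ℤ ^ ∣ U ∣)
    ≡⟨ ∑-allSubsets-suc n _ ⟩
  ∑ (allSubsets n) (λ _ → 0ℤ) + ∑ (allSubsets n) (λ U → ι (U ⊆ᵇ X) * -1ℤ ^ ∣ U ∣)
    ≡⟨ cong₂ _+_ (∑-vanish (allSubsets n) (λ _ → refl)) refl ⟩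
  0ℤ + ∑ (allSubsets n) (λ U → ι (U ⊆ᵇ X) * -1ℤ ^ ∣ U ∣)
    ≡⟨ ℤP.+-identityˡ _ ⟩
  ∑ (allSubsets n) (λ U → ι (U ⊆ᵇ X) * -1ℤ ^ ∣ U ∣) ≡⟨ inclusion-exclusion X ⟩
  ι (isEmptyᵇ X)                                    ≡⟨ cong ι (allFin-suc (λ i → not (i ∈ˢ (false ∷ X)))) ⟨
  ι (isEmptyᵇ (false ∷ X))                          ∎
  where open ≡-Reasoning

∑-allSubsets-one : ∀ n → ∑ (allSubsets n) (λ _ → 1ℤ) ≡ + (2 N.^ n)
∑-allSubsets-one zero = refl
∑-allSubsets-one (suc n) = begin
  ∑ (allSubsets (suc n)) (λ _ → 1ℤ)   ≡⟨ ∑-allSubsets-suc n _ ⟩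
  ∑ (allSubsets n) (λ _ → 1ℤ) + ∑ (allSubsets n) (λ _ → 1ℤ)
                                      ≡⟨ cong₂ _+_ (∑-allSubsets-one n) (∑-allSubsets-one n) ⟩
  + (2 N.^ n) + + (2 N.^ n)           ≡⟨ ℤP.pos-+ (2 N.^ n) (2 N.^ n) ⟨
  + (2 N.^ n N.+ 2 N.^ n)             ≡⟨ cong (λ k → + (2 N.^ n N.+ k)) (NP.+-identityʳ (2 N.^ n)) ⟨
  + (2 N.^ suc n)                     ∎
  where open ≡-Reasoning

∑-split-empty : ∀ n (f : Subset n → ℤ) →
  ∑ (allSubsets n) f ≡ f ∅ + ∑ (allSubsets n) (λ U → ι (nonEmptyᵇ U) * f U)
∑-split-empty zero f = refl
∑-split-empty (suc n) f = begin
  ∑ (allSubsets (suc n)) f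
    ≡⟨ ∑-allSubsets-suc n f ⟩
  ∑ (allSubsets n) (f ∘ (true ∷_)) + ∑ (allSubsets n) (f ∘ (false ∷_))
    ≡⟨ cong₂ _+_ (∑-cong (allSubsets n) (λ U → sym (ℤP.*-identityˡ (f (true ∷ U)))))
                 (∑-split-empty n (f ∘ (false ∷_))) ⟩
  ∑ (allSubsets n) (λ U → 1ℤ * f (true ∷ U)) + (f ∅ + ∑ (allSubsets n) (λ U → ι (nonEmptyᵇ U) * f (false ∷ U)))
    ≡⟨ exchange (∑ (allSubsets n) (λ U → 1ℤ * f (true ∷ U))) (f ∅) _ ⟩
  f ∅ + (∑ (allSubsets n) (λ U → 1ℤ * f (true ∷ U)) + ∑ (allSubsets n) (λ U → ι (nonEmptyᵇ U) * f (false ∷ U)))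
    ≡⟨ cong (_+_ (f ∅)) (∑-allSubsets-suc n (λ U → ι (nonEmptyᵇ U) * f U)) ⟨
  f ∅ + ∑ (allSubsets (suc n)) (λ U → ι (nonEmptyᵇ U) * f U)
    ∎
  where
  open ≡-Reasoning
  exchange : ∀ a b c → a + (b + c) ≡ b + (a + c)
  exchange = solve-∀

∑-alternating-nonempty : ∀ {n} → 1 ≤ n → ∑ (allSubsets n) (λ U → ι (nonEmptyᵇ U) * -1ℤ ^ ∣ U ∣) ≡ -1ℤ
∑-alternating-nonempty {suc m} _ = begin
  S                                               ≡⟨ add-and-subtract-one S ⟩
  (1ℤ + S) - 1ℤ                                   ≡⟨ cong (λ k → (-1ℤ ^ k + S) - 1ℤ) (∣⊥∣≡0 (suc m)) ⟨
  (-1ℤ ^ ∣ ∅ {suc m} ∣ + S) - 1ℤ                  ≡⟨ cong (_- 1ℤ) (∑-split-empty (suc m) (λ U → -1ℤ ^ ∣ U ∣)) ⟨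
  ∑ (allSubsets (suc m)) (λ U → -1ℤ ^ ∣ U ∣) - 1ℤ ≡⟨ cong (_- 1ℤ) alternating-sum-vanishes ⟩
  0ℤ - 1ℤ                                         ≡⟨⟩
  -1ℤ                                             ∎
  where
  open ≡-Reasoning
  S = ∑ (allSubsets (suc m)) (λ U → ι (nonEmptyᵇ U) * -1ℤ ^ ∣ U ∣)
  add-and-subtract-one : ∀ x → x ≡ (1ℤ + x) - 1ℤ
  add-and-subtract-one = solve-∀
  alternating-sum-vanishes : ∑ (allSubsets (suc m)) (λ U → -1ℤ ^ ∣ U ∣) ≡ 0ℤ
  alternating-sum-vanishes = begin
    ∑ (allSubsets (suc m)) (λ U → -1ℤ ^ ∣ U ∣)
      ≡⟨ ∑-cong (allSubsets (suc m)) (λ U → trans (cong (λ b → ι b * -1ℤ ^ ∣ U ∣) (⊆ᵇfull U))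
                                                   (ℤP.*-identityˡ _)) ⟨
    ∑ (allSubsets (suc m)) (λ U → ι (U ⊆ᵇ full) * -1ℤ ^ ∣ U ∣)
      ≡⟨ inclusion-exclusion (full {suc m}) ⟩
    ι (isEmptyᵇ (full {suc m}))
      ≡⟨ cong ι (allFin-suc (λ i → not (i ∈ˢ full {suc m}))) ⟩
    0ℤ ∎

-1^-parity : ∀ k → -1ℤ ^ k ≡ (if isEven k then 1ℤ else -1ℤ)
-1^-parity zero = refl
-1^-parity (suc zero) = refl
-1^-parity (suc (suc k)) = trans (double-negation (-1ℤ ^ k)) (-1^-parity k)
  where
  double-negation : ∀ x → -1ℤ * (-1ℤ * x) ≡ x
  double-negation = solve-∀

sign-sum : ∀ p x y → ι p * ((if x then 1ℤ else -1ℤ) + (if y then 1ℤ else -1ℤ))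
                     ≡ + 2 * (ι (p ∧ (x ∧ y)) - ι (p ∧ (not x ∧ not y)))
sign-sum false _ _ = refl
sign-sum true true true = refl
sign-sum true true false = refl
sign-sum true false true = refl
sign-sum true false false = refl

module _ {n : ℕ} where

  between : Subset n → Subset n → Fin n → Fin n → Bool
  between X Y i j = ((i ∈ˢ X) ∧ (j ∈ˢ Y)) ∨ ((i ∈ˢ Y) ∧ (j ∈ˢ X))

  edgesBetween : Subset n → Subset n → EdgeSet n
  edgesBetween X Y = tabulate (λ i → tabulate (between X Y i))

  inF-edgesBetween : ∀ X Y i j → inF (edgesBetween X Y) i j ≡ between X Y i j
  inF-edgesBetween X Y i j = trans (cong (λ row → lookup row j) (lookup∘tabulate _ i)) (lookup∘tabulate _ j)

  edgesBetween-sym : ∀ X Y → edgesBetween X Y ≡ edgesBetween Y X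
  edgesBetween-sym X Y = tabulate-cong λ i → tabulate-cong λ j → ∨-comm ((i ∈ˢ X) ∧ (j ∈ˢ Y)) _

  record IsCompleteBipartite (F : EdgeSet n) (X Y : Subset n) : Set where
    field
      nonEmptyˡ : T (nonEmptyᵇ X)
      nonEmptyʳ : T (nonEmptyᵇ Y)
      disjoint  : ∀ i → T (i ∈ˢ X) → ¬ T (i ∈ˢ Y)
      edges     : F ≡ edgesBetween X Y

  T-isCompleteBipartiteOn : ∀ F X Y → T (isCompleteBipartiteOn F X Y) ⇔ IsCompleteBipartite F X Y
  T-isCompleteBipartiteOn F X Y = mk⇔ sound complete
    where
    sound : T (isCompleteBipartiteOn F X Y) → IsCompleteBipartite F X Y
    sound h with to (T-∧ {nonEmptyᵇ X}) h
    ... | X≠∅ , h₁ with to (T-∧ {nonEmptyᵇ Y}) h₁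
    ... | Y≠∅ , h₂ with to (T-∧ {allB (allFin n) (λ i → not ((i ∈ˢ X) ∧ (i ∈ˢ Y)))}) h₂
    ... | X∩Y=∅ , agree = record
      { nonEmptyˡ = X≠∅ ; nonEmptyʳ = Y≠∅
      ; disjoint = λ i i∈X i∈Y → to T-not (to T-allFin X∩Y=∅ i) (from T-∧ (i∈X , i∈Y))
      ; edges = vec-ext λ i → trans (vec-ext (entry i)) (sym (lookup∘tabulate _ i)) }
      where
      entry : ∀ i j → inF F i j ≡ lookup (tabulate (between X Y i)) j
      entry i j with inF F i j | to T-allFin (to T-allFin agree i) j
      ... | true | agrees = sym (trans (lookup∘tabulate _ j) (to T-≡ agrees))
      ... | false | agrees = sym (trans (lookup∘tabulate _ j) (to T-not-≡ agrees))
    -- The entry test of isCompleteBipartiteOn is local to its definition, so it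
    -- cannot be stated here; instead a failing entry is exhibited and refuted.
    complete : IsCompleteBipartite F X Y → T (isCompleteBipartiteOn F X Y)
    complete cb with T? (isCompleteBipartiteOn F X Y)
    ... | yes holds = holds
    ... | no fails
      with ¬T-allFin (λ agree → fails (from T-∧ (nonEmptyˡ , from T-∧ (nonEmptyʳ , from T-∧ (disjoint′ , agree)))))
      where
      open IsCompleteBipartite cb
      disjoint′ : T (allB (allFin n) (λ i → not ((i ∈ˢ X) ∧ (i ∈ˢ Y))))
      disjoint′ = from T-allFin λ i → from T-not λ i∈X∩Y → disjoint i (proj₁ (to T-∧ i∈X∩Y)) (proj₂ (to T-∧ i∈X∩Y))
    ... | i , row-fails with ¬T-allFin row-fails
    ... | j , entry-fails
      with inF F i j | trans (cong (λ F → inF F i j) (IsCompleteBipartite.edges cb)) (inF-edgesBetween X Y i j) | entry-fails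
    ... | true | agree | disagrees = ⊥-elim (disagrees (subst T agree _))
    ... | false | agree | disagrees = ⊥-elim (disagrees (subst (T ∘ not) agree _))

  IsCompleteBipartite-sym : ∀ {F X Y} → IsCompleteBipartite F X Y → IsCompleteBipartite F Y X
  IsCompleteBipartite-sym {F} {X} {Y} cb = record
    { nonEmptyˡ = nonEmptyʳ ; nonEmptyʳ = nonEmptyˡ
    ; disjoint = λ i i∈Y i∈X → disjoint i i∈X i∈Y
    ; edges = trans edges (edgesBetween-sym X Y) }
    where open IsCompleteBipartite cb

  open IsCompleteBipartite

  row-of-side : ∀ {F X Y} → IsCompleteBipartite F X Y → ∀ i → T (i ∈ˢ X) → lookup F i ≡ Y
  row-of-side {F} {X} {Y} cb i i∈X =
    trans (cong (λ E → lookup E i) (edges cb)) (trans (lookup∘tabulate _ i) (vec-ext λ j → trans (lookup∘tabulate _ j) (entry j)))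
    where
    entry : ∀ j → between X Y i j ≡ j ∈ˢ Y
    entry j with i ∈ˢ X | i ∈ˢ Y | disjoint cb i
    ... | false | _ | _ = ⊥-elim i∈X
    ... | true | true | i∉Y = ⊥-elim (i∉Y _ _)
    ... | true | false | _ = ∨-identityʳ _

  row-outside : ∀ {F X Y} → IsCompleteBipartite F X Y → ∀ i → ¬ T (i ∈ˢ X) → ¬ T (i ∈ˢ Y) → lookup F i ≡ ∅
  row-outside {F} {X} {Y} cb i i∉X i∉Y =
    trans (cong (λ E → lookup E i) (edges cb)) (trans (lookup∘tabulate _ i) (vec-ext λ j → trans (lookup∘tabulate _ j) (entry j)))
    where
    entry : ∀ j → between X Y i j ≡ j ∈ˢ ∅
    entry j with i ∈ˢ X | i ∈ˢ Y
    ... | true | _ = ⊥-elim (i∉X _)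
    ... | false | true = ⊥-elim (i∉Y _)
    ... | false | false = sym (lookup-replicate j false)

  sides-distinct : ∀ {F X Y} → IsCompleteBipartite F X Y → X ≢ Y
  sides-distinct {X = X} cb refl with nonEmpty⇒member X (nonEmptyˡ cb)
  ... | i , i∈X = disjoint cb i i∈X i∈X

  -- The edge set determines its sides up to order: the row of a vertex of one
  -- side is the other side.
  sides-unique : ∀ {F X Y X′ Y′} → IsCompleteBipartite F X Y → IsCompleteBipartite F X′ Y′ →
                 (X ≡ X′ × Y ≡ Y′) ⊎ (X ≡ Y′ × Y ≡ X′)
  sides-unique {F} {X} {Y} {X′} {Y′} cb cb′
    with nonEmpty⇒member X (nonEmptyˡ cb) | nonEmpty⇒member Y (nonEmptyʳ cb)
  ... | x , x∈X | y , y∈Y with T? (x ∈ˢ X′) | T? (x ∈ˢ Y′)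
  ... | yes x∈X′ | _ = inj₁ (X≡X′ , Y≡Y′)
    where
    Y≡Y′ : Y ≡ Y′
    Y≡Y′ = trans (sym (row-of-side cb x x∈X)) (row-of-side cb′ x x∈X′)
    X≡X′ : X ≡ X′
    X≡X′ = trans (sym (row-of-side (IsCompleteBipartite-sym cb) y y∈Y))
                 (row-of-side (IsCompleteBipartite-sym cb′) y (subst (λ Z → T (y ∈ˢ Z)) Y≡Y′ y∈Y))
  ... | no _ | yes x∈Y′ = inj₂ (X≡Y′ , Y≡X′)
    where
    Y≡X′ : Y ≡ X′
    Y≡X′ = trans (sym (row-of-side cb x x∈X)) (row-of-side (IsCompleteBipartite-sym cb′) x x∈Y′)
    X≡Y′ : X ≡ Y′
    X≡Y′ = trans (sym (row-of-side (IsCompleteBipartite-sym cb) y y∈Y)) (row-of-side cb′ y (subst (λ Z → T (y ∈ˢ Z)) Y≡X′ y∈Y))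
  ... | no x∉X′ | no x∉Y′ = ⊥-elim (subst T (lookup-replicate y false) (subst (λ Z → T (y ∈ˢ Z)) Y≡∅ y∈Y))
    where
    Y≡∅ : Y ≡ ∅
    Y≡∅ = trans (sym (row-of-side cb x x∈X)) (row-outside cb′ x x∉X′ x∉Y′)

module _ {n} (G : SimpleGraph n) where

  open IsCompleteBipartite

  private
    Subsets = allSubsets n

  dominatedBy : Subset n → Fin n → Bool
  dominatedBy W v = (v ∈ˢ W) ∨ anyB (allFin n) (λ w → (w ∈ˢ W) ∧ adj G v w)

  undominated : Subset n → Subset n
  undominated W = tabulate (not ∘ dominatedBy W)

  isDominating≡isEmpty : ∀ W → isDominating G W ≡ isEmptyᵇ (undominated W)
  isDominating≡isEmpty W = cong BL.and (map-cong double-negation (allFin n))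
    where
    double-negation : ∀ v → dominatedBy W v ≡ not (v ∈ˢ undominated W)
    double-negation v = trans (sym (not-involutive _)) (cong not (sym (lookup∘tabulate _ v)))

  dominating-as-sum : + d G ≡ ∑ Subsets (λ W → ∑ Subsets (λ U → ι (U ⊆ᵇ undominated W) * -1ℤ ^ ∣ U ∣))
  dominating-as-sum = trans (count≡∑ (isDominating G) Subsets) (∑-cong Subsets λ W →
    trans (cong ι (isDominating≡isEmpty W)) (sym (inclusion-exclusion (undominated W))))

  coEdge : Fin n → Fin n → Bool
  coEdge i j = not ⌊ i ≟ j ⌋ ∧ not (adj G i j)

  coEdge-irrefl : ∀ i → ¬ T (coEdge i i)
  coEdge-irrefl i with i ≟ i
  ... | yes _ = λ ()
  ... | no i≢i = contradiction refl i≢i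

  coEdge-sym : ∀ i j → coEdge i j ≡ coEdge j i
  coEdge-sym i j rewrite adj-sym G i j with i ≟ j | j ≟ i
  ... | yes _ | yes _ = refl
  ... | no _ | no _ = refl
  ... | yes i≡j | no j≢i = contradiction (sym i≡j) j≢i
  ... | no i≢j | yes j≡i = contradiction (sym j≡i) i≢j

  Separated : Subset n → Subset n → Set
  Separated W U = ∀ w u → T (w ∈ˢ W) → T (u ∈ˢ U) → T (coEdge w u)

  Separated-sym : ∀ W U → Separated W U → Separated U W
  Separated-sym W U sep u w u∈U w∈W = subst T (coEdge-sym w u) (sep w u w∈W u∈U)

  undominated⇔ : ∀ W u → T (u ∈ˢ undominated W) ⇔ (∀ w → T (w ∈ˢ W) → T (coEdge w u))
  undominated⇔ W u = mk⇔ (λ h w w∈W → separated (to T-not (subst T (lookup∘tabulate _ u) h)) w w∈W)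
                         (λ sep → subst T (sym (lookup∘tabulate _ u)) (from T-not (not-dominated sep)))
    where
    adjacent⇒dominated : ∀ w → T (w ∈ˢ W) → T (adj G w u) → T (dominatedBy W u)
    adjacent⇒dominated w w∈W w~u =
      from T-∨ (inj₂ (from T-anyFin (w , from T-∧ (w∈W , subst T (adj-sym G w u) w~u))))
    separated : ¬ T (dominatedBy W u) → ∀ w → T (w ∈ˢ W) → T (coEdge w u)
    separated u∉N[W] w w∈W with w ≟ u
    ... | yes refl = u∉N[W] (from T-∨ (inj₁ w∈W))
    ... | no _ = from T-not (u∉N[W] ∘ adjacent⇒dominated w w∈W)
    not-dominated : (∀ w → T (w ∈ˢ W) → T (coEdge w u)) → ¬ T (dominatedBy W u)
    not-dominated sep u∈N[W] with to T-∨ u∈N[W]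
    ... | inj₁ u∈W = coEdge-irrefl u (sep u u∈W)
    ... | inj₂ w~u with to T-anyFin w~u
    ... | w , w∈W∧u~w with to T-∧ w∈W∧u~w
    ... | w∈W , u~w = to T-not (proj₂ (to T-∧ (sep w w∈W))) (subst T (adj-sym G u w) u~w)

  ⊆undominated⇔Separated : ∀ W U → T (U ⊆ᵇ undominated W) ⇔ Separated W U
  ⊆undominated⇔Separated W U =
    mk⇔ (λ U⊆ w u w∈W u∈U → to (undominated⇔ W u) (⊆ᵇ-sound U (undominated W) U⊆ u u∈U) w w∈W)
        (λ sep → ⊆ᵇ-complete U (undominated W) λ u u∈U → from (undominated⇔ W u) (λ w w∈W → sep w u w∈W u∈U))

  isCoBiclique : Subset n → Subset n → Bool
  isCoBiclique W U = nonEmptyᵇ W ∧ (nonEmptyᵇ U ∧ (U ⊆ᵇ undominated W))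

  T-isCoBiclique : ∀ W U → T (isCoBiclique W U) ⇔ (T (nonEmptyᵇ W) × T (nonEmptyᵇ U) × Separated W U)
  T-isCoBiclique W U = mk⇔ split (λ (W≠∅ , U≠∅ , sep) →
    from T-∧ (W≠∅ , from T-∧ (U≠∅ , from (⊆undominated⇔Separated W U) sep)))
    where
    split : T (isCoBiclique W U) → T (nonEmptyᵇ W) × T (nonEmptyᵇ U) × Separated W U
    split h with to (T-∧ {nonEmptyᵇ W}) h
    ... | W≠∅ , h′ with to (T-∧ {nonEmptyᵇ U}) h′
    ... | U≠∅ , U⊆ = W≠∅ , U≠∅ , to (⊆undominated⇔Separated W U) U⊆

  isCoBiclique-sym : ∀ W U → isCoBiclique W U ≡ isCoBiclique U W
  isCoBiclique-sym W U = T-injective (swap-sides {W} {U}) (swap-sides {U} {W})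
    where
    swap-sides : ∀ {W U} → T (isCoBiclique W U) → T (isCoBiclique U W)
    swap-sides {W} {U} h with to (T-isCoBiclique W U) h
    ... | W≠∅ , U≠∅ , sep = from (T-isCoBiclique U W) (U≠∅ , W≠∅ , Separated-sym W U sep)

  signedCoBicliques : ℤ
  signedCoBicliques = ∑ Subsets (λ W → ∑ Subsets (λ U → ι (isCoBiclique W U) * -1ℤ ^ ∣ U ∣))

  -- Isolating the terms with U = ∅ and with W = ∅ in the inclusion–exclusion
  -- expansion of d(G) leaves exactly the co-biclique pairs.
  dominating-expansion : 1 ≤ n → + d G ≡ + (2 N.^ n) + (-1ℤ + signedCoBicliques)
  dominating-expansion 1≤n = begin
    + d G
      ≡⟨ dominating-as-sum ⟩
    ∑ Subsets (λ W → ∑ Subsets (λ U → ι (U ⊆ᵇ undominated W) * -1ℤ ^ ∣ U ∣))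
      ≡⟨ ∑-cong Subsets (λ W → trans (∑-split-empty n _) (cong (_+ k W) (U=∅-term W))) ⟩
    ∑ Subsets (λ W → 1ℤ + k W)
      ≡⟨ ∑-+ Subsets (λ _ → 1ℤ) k ⟩
    ∑ Subsets (λ _ → 1ℤ) + ∑ Subsets k
      ≡⟨ cong₂ _+_ (∑-allSubsets-one n) (∑-split-empty n k) ⟩
    + (2 N.^ n) + (k ∅ + ∑ Subsets (λ W → ι (nonEmptyᵇ W) * k W))
      ≡⟨ cong (λ x → + (2 N.^ n) + (x + ∑ Subsets (λ W → ι (nonEmptyᵇ W) * k W))) W=∅-term ⟩
    + (2 N.^ n) + (-1ℤ + ∑ Subsets (λ W → ι (nonEmptyᵇ W) * k W))
      ≡⟨ cong (λ x → + (2 N.^ n) + (-1ℤ + x)) (∑-cong Subsets W≠∅-terms) ⟩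
    + (2 N.^ n) + (-1ℤ + signedCoBicliques)
      ∎
    where
    open ≡-Reasoning
    k : Subset n → ℤ
    k W = ∑ Subsets (λ U → ι (nonEmptyᵇ U) * (ι (U ⊆ᵇ undominated W) * -1ℤ ^ ∣ U ∣))
    U=∅-term : ∀ W → ι (∅ ⊆ᵇ undominated W) * -1ℤ ^ ∣ ∅ {n} ∣ ≡ 1ℤ
    U=∅-term W rewrite ∅⊆ᵇ (undominated W) | ∣⊥∣≡0 n = refl
    ⊆undominated-∅ : ∀ U → U ⊆ᵇ undominated ∅ ≡ true
    ⊆undominated-∅ U = to T-≡ (from (⊆undominated⇔Separated ∅ U)
      (λ w _ w∈∅ _ → ⊥-elim (subst T (lookup-replicate w false) w∈∅)))
    W=∅-term : k ∅ ≡ -1ℤ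
    W=∅-term = trans (∑-cong Subsets drop-condition) (∑-alternating-nonempty 1≤n)
      where
      drop-condition : ∀ U → ι (nonEmptyᵇ U) * (ι (U ⊆ᵇ undominated ∅) * -1ℤ ^ ∣ U ∣)
                           ≡ ι (nonEmptyᵇ U) * -1ℤ ^ ∣ U ∣
      drop-condition U rewrite ⊆undominated-∅ U = cong (ι (nonEmptyᵇ U) *_) (ℤP.*-identityˡ _)
    W≠∅-terms : ∀ W → ι (nonEmptyᵇ W) * k W ≡ ∑ Subsets (λ U → ι (isCoBiclique W U) * -1ℤ ^ ∣ U ∣)
    W≠∅-terms W = trans (sym (∑-*ˡ Subsets (ι (nonEmptyᵇ W)) _))
                        (∑-cong Subsets λ U → ι-∧₃ (nonEmptyᵇ W) (nonEmptyᵇ U) _ _)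

  T-⊆coEdges : ∀ F → T (⊆coEdges G F) ⇔ (∀ i j → T (inF F i j) → T (coEdge i j))
  T-⊆coEdges F = mk⇔ (λ h i j → to T-implies (to T-allFin (to T-allFin h i) j))
                   (λ h → from T-allFin λ i → from T-allFin λ j → from T-implies (h i j))

  edgesBetween-in-complement : ∀ X Y →
    (⊆coEdges G (edgesBetween X Y) ∧ isCompleteBipartiteOn (edgesBetween X Y) X Y) ≡ isCoBiclique X Y
  edgesBetween-in-complement X Y = T-injective sound complete
    where
    E = edgesBetween X Y
    sound : T (⊆coEdges G E ∧ isCompleteBipartiteOn E X Y) → T (isCoBiclique X Y)
    sound h with to (T-∧ {⊆coEdges G E}) h
    ... | E⊆Ḡ , E-bipartite = from (T-isCoBiclique X Y) (nonEmptyˡ cb , nonEmptyʳ cb , separated)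
      where
      cb : IsCompleteBipartite E X Y
      cb = to (T-isCompleteBipartiteOn E X Y) E-bipartite
      separated : Separated X Y
      separated x y x∈X y∈Y = to (T-⊆coEdges E) E⊆Ḡ x y
        (subst T (sym (inF-edgesBetween X Y x y)) (from T-∨ (inj₁ (from T-∧ (x∈X , y∈Y)))))
    complete : T (isCoBiclique X Y) → T (⊆coEdges G E ∧ isCompleteBipartiteOn E X Y)
    complete h with to (T-isCoBiclique X Y) h
    ... | X≠∅ , Y≠∅ , sep = from T-∧ (from (T-⊆coEdges E) E⊆Ḡ , from (T-isCompleteBipartiteOn E X Y) cb)
      where
      cb : IsCompleteBipartite E X Y
      cb = record { nonEmptyˡ = X≠∅ ; nonEmptyʳ = Y≠∅ ; edges = refl
                  ; disjoint = λ i i∈X i∈Y → coEdge-irrefl i (sep i i i∈X i∈Y) }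
      E⊆Ḡ : ∀ i j → T (inF E i j) → T (coEdge i j)
      E⊆Ḡ i j ij∈E with to T-∨ (subst T (inF-edgesBetween X Y i j) ij∈E)
      ... | inj₁ i∈X∧j∈Y = sep i j (proj₁ (to T-∧ i∈X∧j∈Y)) (proj₂ (to T-∧ i∈X∧j∈Y))
      ... | inj₂ i∈Y∧j∈X = Separated-sym X Y sep i j (proj₁ (to T-∧ i∈Y∧j∈X)) (proj₂ (to T-∧ i∈Y∧j∈X))

  -- For given sides, the only edge set counted is edgesBetween X Y.
  ∑-edgeSets-with-sides : (par : Subset n → Subset n → Bool) → ∀ X Y →
    ∑ (allEdgeSets n) (λ F → ι (⊆coEdges G F ∧ (isCompleteBipartiteOn F X Y ∧ par X Y)))
      ≡ ι (isCoBiclique X Y ∧ par X Y)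
  ∑-edgeSets-with-sides par X Y = begin
    ∑ (allEdgeSets n) (λ F → ι (⊆coEdges G F ∧ (isCompleteBipartiteOn F X Y ∧ par X Y)))
      ≡⟨ allEdgeSets-enumerates n _ E other-edge-sets ⟩
    ι (⊆coEdges G E ∧ (isCompleteBipartiteOn E X Y ∧ par X Y))
      ≡⟨ cong ι (∧-assoc (⊆coEdges G E) _ (par X Y)) ⟨
    ι ((⊆coEdges G E ∧ isCompleteBipartiteOn E X Y) ∧ par X Y)
      ≡⟨ cong (λ b → ι (b ∧ par X Y)) (edgesBetween-in-complement X Y) ⟩
    ι (isCoBiclique X Y ∧ par X Y) ∎
    where
    open ≡-Reasoning
    E = edgesBetween X Y
    other-edge-sets : ∀ F → F ≢ E → ι (⊆coEdges G F ∧ (isCompleteBipartiteOn F X Y ∧ par X Y)) ≡ 0ℤ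
    other-edge-sets F F≢E = ι-false λ h →
      F≢E (edges (to (T-isCompleteBipartiteOn F X Y) (proj₁ (to (T-∧ {isCompleteBipartiteOn F X Y}) (proj₂ (to (T-∧ {⊆coEdges G F}) h))))))

  -- Counting ordered co-biclique pairs with a symmetric side condition: each
  -- complete bipartite edge set of Ḡ arises from exactly two ordered pairs.
  ∑-coBicliques : (par : Subset n → Subset n → Bool) → (∀ X Y → par X Y ≡ par Y X) →
    ∑ Subsets (λ X → ∑ Subsets (λ Y → ι (isCoBiclique X Y ∧ par X Y)))
      ≡ + 2 * ∑ (allEdgeSets n) (λ F → ι (⊆coEdges G F ∧
                  anyB Subsets (λ X → anyB Subsets (λ Y → isCompleteBipartiteOn F X Y ∧ par X Y))))
  ∑-coBicliques par par-sym = begin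
    ∑ Subsets (λ X → ∑ Subsets (λ Y → ι (isCoBiclique X Y ∧ par X Y)))
      ≡⟨ ∑-cong Subsets (λ X → ∑-cong Subsets (λ Y → sym (∑-edgeSets-with-sides par X Y))) ⟩
    ∑ Subsets (λ X → ∑ Subsets (λ Y → ∑ Edges (λ F → counted F X Y)))
      ≡⟨ ∑-cong Subsets (λ X → ∑-swap Subsets Edges (λ Y F → counted F X Y)) ⟩
    ∑ Subsets (λ X → ∑ Edges (λ F → ∑ Subsets (λ Y → counted F X Y)))
      ≡⟨ ∑-swap Subsets Edges (λ X F → ∑ Subsets (λ Y → counted F X Y)) ⟩
    ∑ Edges (λ F → ∑ Subsets (λ X → ∑ Subsets (λ Y → counted F X Y)))
      ≡⟨ ∑-cong Edges bipartitions ⟩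
    ∑ Edges (λ F → + 2 * ι (⊆coEdges G F ∧ anyB Subsets (λ X → anyB Subsets (λ Y → q F X Y))))
      ≡⟨ ∑-*ˡ Edges (+ 2) _ ⟩
    + 2 * ∑ Edges (λ F → ι (⊆coEdges G F ∧ anyB Subsets (λ X → anyB Subsets (λ Y → q F X Y)))) ∎
    where
    open ≡-Reasoning
    Edges = allEdgeSets n
    q : EdgeSet n → Subset n → Subset n → Bool
    q F X Y = isCompleteBipartiteOn F X Y ∧ par X Y
    counted : EdgeSet n → Subset n → Subset n → ℤ
    counted F X Y = ι (⊆coEdges G F ∧ q F X Y)
    bipartite : ∀ {F X Y} → T (q F X Y) → IsCompleteBipartite F X Y
    bipartite {F} {X} {Y} h = to (T-isCompleteBipartiteOn F X Y) (proj₁ (to (T-∧ {isCompleteBipartiteOn F X Y}) h))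
    q-sym : ∀ {F X Y} → T (q F X Y) → T (q F Y X)
    q-sym {F} {X} {Y} h = from T-∧ ( from (T-isCompleteBipartiteOn F Y X) (IsCompleteBipartite-sym (bipartite {F} {X} {Y} h))
                                   , subst T (par-sym X Y) (proj₂ (to (T-∧ {isCompleteBipartiteOn F X Y}) h)))
    bipartitions : ∀ F → ∑ Subsets (λ X → ∑ Subsets (λ Y → counted F X Y))
                         ≡ + 2 * ι (⊆coEdges G F ∧ anyB Subsets (λ X → anyB Subsets (λ Y → q F X Y)))
    bipartitions F with ⊆coEdges G F
    ... | false = ∑-vanish Subsets (λ X → ∑-vanish Subsets (λ Y → refl))
    ... | true = ∑∑-unordered-pair (≡-dec _≟ᵇ_) {Subsets} (allSubsets-enumerates n) (q F) (q-sym {F})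
                   (λ h → sides-distinct (bipartite {F} h) refl)
                   (λ h h′ → sides-unique (bipartite {F} h) (bipartite {F} h′))

  evenSides oddSides : Subset n → Subset n → Bool
  evenSides X Y = isEven ∣ X ∣ ∧ isEven ∣ Y ∣
  oddSides X Y = isOdd ∣ X ∣ ∧ isOdd ∣ Y ∣

  ∑-evenSides : ∑ Subsets (λ W → ∑ Subsets (λ U → ι (isCoBiclique W U ∧ evenSides W U))) ≡ + 2 * + a G
  ∑-evenSides = trans (∑-coBicliques evenSides (λ X Y → ∧-comm (isEven ∣ X ∣) _))
                      (cong (_*_ (+ 2)) (sym (count≡∑ (isEvenEven G) (allEdgeSets n))))

  ∑-oddSides : ∑ Subsets (λ W → ∑ Subsets (λ U → ι (isCoBiclique W U ∧ oddSides W U))) ≡ + 2 * + b G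
  ∑-oddSides = trans (∑-coBicliques oddSides (λ X Y → ∧-comm (isOdd ∣ X ∣) _))
                     (cong (_*_ (+ 2)) (sym (count≡∑ (isOddOdd G) (allEdgeSets n))))

  signedCoBicliques-swap : signedCoBicliques ≡ ∑ Subsets (λ W → ∑ Subsets (λ U → ι (isCoBiclique W U) * -1ℤ ^ ∣ W ∣))
  signedCoBicliques-swap =
    trans (∑-swap Subsets Subsets (λ W U → ι (isCoBiclique W U) * -1ℤ ^ ∣ U ∣))
          (∑-cong Subsets λ U → ∑-cong Subsets λ W → cong (λ c → ι c * -1ℤ ^ ∣ U ∣) (isCoBiclique-sym W U))

  pair-contribution : ∀ W U →
    ι (isCoBiclique W U) * -1ℤ ^ ∣ W ∣ + ι (isCoBiclique W U) * -1ℤ ^ ∣ U ∣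
      ≡ + 2 * (ι (isCoBiclique W U ∧ evenSides W U) - ι (isCoBiclique W U ∧ oddSides W U))
  pair-contribution W U = begin
    ι (isCoBiclique W U) * -1ℤ ^ ∣ W ∣ + ι (isCoBiclique W U) * -1ℤ ^ ∣ U ∣
      ≡⟨ ℤP.*-distribˡ-+ (ι (isCoBiclique W U)) _ _ ⟨
    ι (isCoBiclique W U) * (-1ℤ ^ ∣ W ∣ + -1ℤ ^ ∣ U ∣)
      ≡⟨ cong₂ (λ x y → ι (isCoBiclique W U) * (x + y)) (-1^-parity ∣ W ∣) (-1^-parity ∣ U ∣) ⟩
    ι (isCoBiclique W U) * ((if isEven ∣ W ∣ then 1ℤ else -1ℤ) + (if isEven ∣ U ∣ then 1ℤ else -1ℤ))
      ≡⟨ sign-sum (isCoBiclique W U) (isEven ∣ W ∣) (isEven ∣ U ∣) ⟩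
    + 2 * (ι (isCoBiclique W U ∧ evenSides W U) - ι (isCoBiclique W U ∧ oddSides W U)) ∎
    where open ≡-Reasoning

  -- Adding the two forms of the signed count and summing the pair contributions.
  signedCoBicliques≡ : signedCoBicliques ≡ + 2 * + a G - + 2 * + b G
  signedCoBicliques≡ = ℤP.*-cancelˡ-≡ (+ 2) _ _ (begin
    + 2 * S                                               ≡⟨ double S ⟩
    S + S                                                 ≡⟨ cong (_+ S) signedCoBicliques-swap ⟩
    ∑ Subsets (λ W → ∑ Subsets (signed W W)) + S          ≡⟨ ∑-+ Subsets _ _ ⟨
    ∑ Subsets (λ W → ∑ Subsets (signed W W) + ∑ Subsets (λ U → signed U W U))
                                                          ≡⟨ ∑-cong Subsets (λ W → sym (∑-+ Subsets _ _)) ⟩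
    ∑ Subsets (λ W → ∑ Subsets (λ U → signed W W U + signed U W U))
                                                          ≡⟨ ∑-cong Subsets (λ W → ∑-cong Subsets (pair-contribution W)) ⟩
    ∑ Subsets (λ W → ∑ Subsets (λ U → + 2 * (even W U - odd W U)))
                                                          ≡⟨ ∑-cong Subsets (λ W → ∑-scaled-difference Subsets (+ 2) _ _) ⟩
    ∑ Subsets (λ W → + 2 * (∑ Subsets (even W) - ∑ Subsets (odd W)))
                                                          ≡⟨ ∑-scaled-difference Subsets (+ 2) _ _ ⟩
    + 2 * (∑ Subsets (λ W → ∑ Subsets (even W)) - ∑ Subsets (λ W → ∑ Subsets (odd W)))
                                                          ≡⟨ cong (_*_ (+ 2)) (cong₂ _-_ ∑-evenSides ∑-oddSides) ⟩
    + 2 * (+ 2 * + a G - + 2 * + b G)                     ∎)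
    where
    open ≡-Reasoning
    S = signedCoBicliques
    signed : Subset n → Subset n → Subset n → ℤ
    signed V W U = ι (isCoBiclique W U) * -1ℤ ^ ∣ V ∣
    even odd : Subset n → Subset n → ℤ
    even W U = ι (isCoBiclique W U ∧ evenSides W U)
    odd W U = ι (isCoBiclique W U ∧ oddSides W U)
    double : ∀ x → + 2 * x ≡ x + x
    double = solve-∀

mainTheorem1 : (n : ℕ) → 1 ≤ n → (G : SimpleGraph n) →
    + d G ≡ (+ (2 N.^ n) - + 1) + + 2 * (+ a G - + b G)
mainTheorem1 n 1≤n G = begin
  + d G                                                 ≡⟨ dominating-expansion G 1≤n ⟩
  + (2 N.^ n) + (-1ℤ + signedCoBicliques G)             ≡⟨ cong (λ s → + (2 N.^ n) + (-1ℤ + s)) (signedCoBicliques≡ G) ⟩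
  + (2 N.^ n) + (-1ℤ + (+ 2 * + a G - + 2 * + b G))     ≡⟨ regroup (+ (2 N.^ n)) (+ a G) (+ b G) ⟩
  (+ (2 N.^ n) - + 1) + + 2 * (+ a G - + b G)           ∎
  where
  open ≡-Reasoning
  regroup : ∀ x y z → x + (-1ℤ + (+ 2 * y - + 2 * z)) ≡ (x - + 1) + + 2 * (y - z)
  regroup = solve-∀
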